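{- Let $b\ge 2$ be an integer and let $x=0.a_1a_2a_3\cdots$ (base-$b$ expansion, digits $a_j\in\{0,1,\dots,b-1\}$) be normal to base $b$. Let $(n_i)_{i\ge1}$ be the increasing sequence of positive integers such that a positive integer $n$ equals $n_i$ for some $i$ if and only if $0\le a_n<b-1$. Then the number $0.a_{n_1}a_{n_2}a_{n_3}\cdots$, whose digits lie in $\{0,1,\dots,b-2\}$, is normal to base $b-1$.
   Context: For an integer base $B\ge 1$, a digit sequence $0.d_1d_2d_3\cdots$ with $d_j\in\{0,\dots,B-1\}$ is normal to base $B$ if for every $k\ge1$ and every finite string $[c_1,\dots,c_k]$ of digits in $\{0,\dots,B-1\}$, \[ \lim_{n\to\infty}\frac{\#\{0\le i\le n-1:\ d_{i+j}=c_j \text{ for } 1\le j\le k\}}{n}=\frac{1}{B^k}. \] In words: removing all digits equal to $b-1$ from the base-$b$ expansion of a base-$b$ normal number yields a base-$(b-1)$ normal expansion. -}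

module Defs where

open import Data.Nat as ℕ using (ℕ; zero; suc; _+_; _^_; _∸_; _≤_; _<_; NonZero; s≤s; z≤n)
open import Data.Nat.Properties using (m^n≢0)
open import Data.Fin as Fin using (Fin)
open import Data.Vec using (Vec; []; _∷_)
open import Data.Bool using (Bool; true; false; _∧_; if_then_else_)
open import Data.Integer using (+_)
open import Data.Rational using (ℚ; _/_; _-_; ∣_∣; _<_; 0ℚ)
open import Data.Product using (∃-syntax)
open import Relation.Nullary.Decidable using (⌊_⌋)

-- A digit sequence in base B, 0-indexed: d i is the (i+1)-st digit d_{i+1}.
Digits : ℕ → Set
Digits B = ℕ → Fin B

-- matchAt d i c = true  iff  d (i + j) ≡ c_j for all positions j of the string c
-- (i.e. d_{i+1} … d_{i+k} equals c_1 … c_k in the paper's 1-indexed notation).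
matchAt : ∀ {B k} → Digits B → ℕ → Vec (Fin B) k → Bool
matchAt d i []      = true
matchAt d i (x ∷ c) = ⌊ d i Fin.≟ x ⌋ ∧ matchAt d (suc i) c

count : ∀ {B k} → Digits B → Vec (Fin B) k → ℕ → ℕ
count d c zero    = 0
count d c (suc n) = count d c n + (if matchAt d n c then 1 else 0)

ConvergesTo : ((n : ℕ) → .{{NonZero n}} → ℚ) → ℚ → Set
ConvergesTo f L =
  ∀ (ε : ℚ) → 0ℚ Data.Rational.< ε →
    ∃[ N ] (∀ (n : ℕ) .{{_ : NonZero n}} → N ≤ n → ∣ f n - L ∣ Data.Rational.< ε)

Normal : (B : ℕ) → .{{NonZero B}} → Digits B → Set
Normal B d =
  ∀ (k : ℕ) (c : Vec (Fin B) k) →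
    ConvergesTo (λ n → (+ count d c n) / n) (_/_ (+ 1) (B ^ k) {{m^n≢0 B k}})

nonZero-b : ∀ {b} → 2 ≤ b → NonZero b
nonZero-b (s≤s _) = _

nonZero-b-1 : ∀ {b} → 2 ≤ b → NonZero (b ∸ 1)
nonZero-b-1 (s≤s (s≤s _)) = _

module Submission where

-- Write b = s + 1 and call the digits below s kept, so that d lists the kept digits of a.
-- An occurrence of a string e ∷ c in d is a kept position p of a carrying e whose following
-- kept digits begin with c. Reading the window of the L digits after p: if its kept digits
-- begin with c, then e ∷ c occurs at p, and conversely unless the window has fewer than |c|
-- kept digits. By normality of a, such positions occur with the frequency of the corresponding
-- words among all words, and kept positions have density s / b. Dividing, the frequency of
-- e ∷ c in d lies between (1 - τ) / s^(|c|+1) and (1 - τ) / s^(|c|+1) + τ, where τ is the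
-- proportion of words of length L with fewer than |c| kept digits; and τ → 0 as L → ∞.

open import Defs
open import Data.Nat using (ℕ; suc; _≤_; _<_; _∸_)
open import Data.Fin using (Fin; toℕ)
open import Data.Product using (∃-syntax)
open import Relation.Binary.PropositionalEquality using (_≡_)

open import Data.Nat as ℕ using (zero; _+_; _*_; _^_; _⊔_; z≤n; s≤s; NonZero)
import Data.Nat.Properties as ℕ
open import Data.Nat.Tactic.RingSolver using (solve; solve-∀)
open import Data.Fin as Fin using (zero; suc)
open import Data.Bool using (Bool; true; false; _∧_; if_then_else_; T)
open import Data.Maybe as Maybe using (Maybe; just; nothing; maybe′; is-just)
open import Data.List using ([]; _∷_)
open import Data.Product using (_×_; _,_; proj₁; proj₂)
open import Data.Sum as Sum using (_⊎_; inj₁; inj₂)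
open import Relation.Nullary using (contradiction)
open import Relation.Binary.Definitions using (tri<; tri≈; tri>)
open import Data.Empty using (⊥-elim)
open import Function using (id; _∘_)
open import Relation.Nullary.Decidable using (⌊_⌋; yes; no; ⌊⌋-map′; toWitness; fromWitness)
open import Data.Bool.Properties using (T-∧)
open import Data.Maybe.Properties using (just-injective)
open import Function.Bundles using (Equivalence)
open import Relation.Binary.PropositionalEquality
  using (refl; sym; trans; cong; cong₂; subst; subst₂; _≗_; _≢_; module ≡-Reasoning)
open import Data.Integer as ℤ using (-[1+_]; +[1+_]; _⊖_)
import Data.Integer.Properties as ℤ
open import Data.Integer.GCD using (gcd)
open import Data.Rational as ℚ using (mkℚ; toℚᵘ; 0ℚ)
import Data.Rational.Properties as ℚ
open import Data.Rational.Unnormalised as ℚᵘ using (mkℚᵘ; *<*; *≤*; *≡*)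
import Data.Rational.Unnormalised.Properties as ℚᵘ
open import Algebra.Properties.Semiring.Sum ℕ.+-*-semiring
  using (sum-syntax; ∑-distrib-+; *-distribˡ-sum; sum-cong-≗)

𝟙 : Bool → ℕ
𝟙 b = if b then 1 else 0

𝟙-∧ : ∀ x y → 𝟙 (x ∧ y) ≡ 𝟙 x * 𝟙 y
𝟙-∧ true  y = sym (ℕ.+-identityʳ (𝟙 y))
𝟙-∧ false y = refl

∑-const : ∀ n x → ∑[ i < n ] x ≡ n * x
∑-const zero    x = refl
∑-const (suc n) x = cong (x +_) (∑-const n x)

∑-δ : ∀ {n} (y : Fin n) (S : Fin n → ℕ) → ∑[ x < n ] (𝟙 ⌊ y Fin.≟ x ⌋ * S x) ≡ S y
∑-δ {suc n} zero S = trans (cong₂ _+_ (ℕ.+-identityʳ (S zero)) (∑-const n 0))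
                           (trans (cong (S zero +_) (ℕ.*-zeroʳ n)) (ℕ.+-identityʳ (S zero)))
∑-δ {suc n} (suc y) S =
  trans (sum-cong-≗ λ x → cong (λ b → 𝟙 b * S (suc x)) (⌊⌋-map′ _ _ (y Fin.≟ x)))
        (∑-δ y (S ∘ suc))

≟-sym : ∀ {n} (x y : Fin n) → ⌊ x Fin.≟ y ⌋ ≡ ⌊ y Fin.≟ x ⌋
≟-sym x y with x Fin.≟ y | y Fin.≟ x
... | yes _  | yes _  = refl
... | no  _  | no  _  = refl
... | yes p  | no ¬p  = contradiction (sym p) ¬p
... | no ¬p  | yes p  = contradiction (sym p) ¬p

𝟙-mono : ∀ {x y} → (T x → T y) → 𝟙 x ≤ 𝟙 y
𝟙-mono {false}        _ = z≤n
𝟙-mono {true} {true}  _ = ℕ.≤-refl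
𝟙-mono {true} {false} h = ⊥-elim (h _)

𝟙-≤-+ : ∀ {x y z} → (T x → T y ⊎ T z) → 𝟙 x ≤ 𝟙 y + 𝟙 z
𝟙-≤-+ {false}                _ = z≤n
𝟙-≤-+ {true} {true}          _ = s≤s z≤n
𝟙-≤-+ {true} {false} {true}  _ = ℕ.≤-refl
𝟙-≤-+ {true} {false} {false} h with h _
... | inj₁ ()
... | inj₂ ()

-- Asymptotic ratios of counting functions

Eventually : (ℕ → Set) → Set
Eventually P = ∃[ N ] (∀ M → N ≤ M → P M)

eventually-map : ∀ {P Q : ℕ → Set} → (∀ {M} → P M → Q M) → Eventually P → Eventually Q
eventually-map f (N , p) = N , λ M N≤M → f (p M N≤M)

eventually-zip : ∀ {P Q : ℕ → Set} → Eventually P → Eventually Q → Eventually (λ M → P M × Q M)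
eventually-zip (N₁ , p) (N₂ , q) =
  N₁ ⊔ N₂ , λ M le → p M (ℕ.≤-trans (ℕ.m≤m⊔n N₁ N₂) le) , q M (ℕ.≤-trans (ℕ.m≤n⊔m N₁ N₂) le)

-- f M / g M ≤ p / q + 1 / R, resp. ≥ p / q - 1 / R, for all large M, with denominators cleared.
record RatioAtMost (f g : ℕ → ℕ) (p q : ℕ) : Set where
  constructor ratioAtMost
  field atMost : ∀ R → Eventually λ M → f M * q * R ≤ p * g M * R + g M * q

record RatioAtLeast (f g : ℕ → ℕ) (p q : ℕ) : Set where
  constructor ratioAtLeast
  field atLeast : ∀ R → Eventually λ M → p * g M * R ≤ f M * q * R + g M * q

record Density (f : ℕ → ℕ) (p q : ℕ) : Set where
  constructor density
  field
    upper : RatioAtMost f id p q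
    lower : RatioAtLeast f id p q

private
  halve-+ : ∀ {x₁ y₁ x₂ y₂} e R → x₁ * (2 * R) ≤ y₁ * (2 * R) + e → x₂ * (2 * R) ≤ y₂ * (2 * R) + e →
            (x₁ + x₂) * R ≤ (y₁ + y₂) * R + e
  halve-+ {x₁} {y₁} {x₂} {y₂} e R h₁ h₂ = ℕ.*-cancelˡ-≤ 2 (begin
    2 * ((x₁ + x₂) * R)                          ≡⟨ solve (x₁ ∷ x₂ ∷ R ∷ []) ⟩
    x₁ * (2 * R) + x₂ * (2 * R)                  ≤⟨ ℕ.+-mono-≤ h₁ h₂ ⟩
    (y₁ * (2 * R) + e) + (y₂ * (2 * R) + e)      ≡⟨ solve (y₁ ∷ y₂ ∷ R ∷ e ∷ []) ⟩
    2 * ((y₁ + y₂) * R + e)                      ∎)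
    where open ℕ.≤-Reasoning

  rescale : ∀ {x y} e c R → x * (R * c) ≤ y * (R * c) + e → c * x * R ≤ c * y * R + e
  rescale {x} {y} e c R h = begin
    c * x * R        ≡⟨ solve (c ∷ x ∷ R ∷ []) ⟩
    x * (R * c)      ≤⟨ h ⟩
    y * (R * c) + e  ≡⟨ cong (_+ e) (solve (c ∷ y ∷ R ∷ [])) ⟩
    c * y * R + e    ∎
    where open ℕ.≤-Reasoning

module _ {f f′ h : ℕ → ℕ} {p p′ q : ℕ} where

  atMost-+ : RatioAtMost f h p q → RatioAtMost f′ h p′ q →
             RatioAtMost (λ M → f M + f′ M) h (p + p′) q
  atMost-+ (ratioAtMost bound) (ratioAtMost bound′) = ratioAtMost λ R →
    eventually-map (step R) (eventually-zip (bound (2 * R)) (bound′ (2 * R)))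
    where
    step : ∀ R {M} → f M * q * (2 * R) ≤ p * h M * (2 * R) + h M * q ×
                     f′ M * q * (2 * R) ≤ p′ * h M * (2 * R) + h M * q →
           (f M + f′ M) * q * R ≤ (p + p′) * h M * R + h M * q
    step R {M} (h₁ , h₂) =
      subst₂ (λ u v → u * R ≤ v * R + h M * q) (sym (ℕ.*-distribʳ-+ q (f M) (f′ M)))
             (sym (ℕ.*-distribʳ-+ (h M) p p′)) (halve-+ {f M * q} {p * h M} (h M * q) R h₁ h₂)

  atLeast-+ : RatioAtLeast f h p q → RatioAtLeast f′ h p′ q →
              RatioAtLeast (λ M → f M + f′ M) h (p + p′) q
  atLeast-+ (ratioAtLeast bound) (ratioAtLeast bound′) = ratioAtLeast λ R →
    eventually-map (step R) (eventually-zip (bound (2 * R)) (bound′ (2 * R)))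
    where
    step : ∀ R {M} → p * h M * (2 * R) ≤ f M * q * (2 * R) + h M * q ×
                     p′ * h M * (2 * R) ≤ f′ M * q * (2 * R) + h M * q →
           (p + p′) * h M * R ≤ (f M + f′ M) * q * R + h M * q
    step R {M} (h₁ , h₂) =
      subst₂ (λ u v → u * R ≤ v * R + h M * q) (sym (ℕ.*-distribʳ-+ (h M) p p′))
             (sym (ℕ.*-distribʳ-+ q (f M) (f′ M))) (halve-+ {p * h M} {f M * q} (h M * q) R h₁ h₂)

module _ {f h : ℕ → ℕ} {p q : ℕ} (c : ℕ) where

  atMost-* : RatioAtMost f h p q → RatioAtMost (λ M → c * f M) h (c * p) q
  atMost-* (ratioAtMost bound) = ratioAtMost λ R → eventually-map (step R) (bound (R * c))
    where
    step : ∀ R {M} → f M * q * (R * c) ≤ p * h M * (R * c) + h M * q →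
           c * f M * q * R ≤ c * p * h M * R + h M * q
    step R {M} le = subst₂ (λ u v → u * R ≤ v * R + h M * q) (sym (ℕ.*-assoc c (f M) q))
                         (sym (ℕ.*-assoc c p (h M))) (rescale (h M * q) c R le)

  atLeast-* : RatioAtLeast f h p q → RatioAtLeast (λ M → c * f M) h (c * p) q
  atLeast-* (ratioAtLeast bound) = ratioAtLeast λ R → eventually-map (step R) (bound (R * c))
    where
    step : ∀ R {M} → p * h M * (R * c) ≤ f M * q * (R * c) + h M * q →
           c * p * h M * R ≤ c * f M * q * R + h M * q
    step R {M} le = subst₂ (λ u v → u * R ≤ v * R + h M * q) (sym (ℕ.*-assoc c p (h M)))
                         (sym (ℕ.*-assoc c (f M) q)) (rescale (h M * q) c R le)

density-+ : ∀ {f f′ p p′ q} → Density f p q → Density f′ p′ q → Density (λ M → f M + f′ M) (p + p′) q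
density-+ (density upper lower) (density upper′ lower′) = density (atMost-+ upper upper′) (atLeast-+ lower lower′)

density-* : ∀ {f p q} c → Density f p q → Density (λ M → c * f M) (c * p) q
density-* c (density upper lower) = density (atMost-* c upper) (atLeast-* c lower)

density-∑ : ∀ {n q} (F : Fin n → ℕ → ℕ) (P : Fin n → ℕ) → (∀ i → Density (F i) (P i) q) →
            Density (λ M → ∑[ i < n ] F i M) (∑[ i < n ] P i) q
density-∑ {zero}  F P dens = density (ratioAtMost λ R → 0 , λ M _ → z≤n) (ratioAtLeast λ R → 0 , λ M _ → z≤n)
density-∑ {suc n} F P dens = density-+ (dens zero) (density-∑ (F ∘ suc) (P ∘ suc) (dens ∘ suc))

density-cong : ∀ {f f′ p p′ q} → f ≗ f′ → p ≡ p′ → Density f p q → Density f′ p′ q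
density-cong {p = p} {q = q} f≗f′ refl (density (ratioAtMost upper) (ratioAtLeast lower)) = density
  (ratioAtMost λ R → eventually-map (λ {M} → subst (λ t → t * q * R ≤ p * M * R + M * q) (f≗f′ M)) (upper R))
  (ratioAtLeast λ R → eventually-map (λ {M} → subst (λ t → p * M * R ≤ t * q * R + M * q) (f≗f′ M)) (lower R))

atMost-mono : ∀ {f f′ g p q} → (∀ M → f M ≤ f′ M) → RatioAtMost f′ g p q → RatioAtMost f g p q
atMost-mono {p = p} {q} f≤f′ (ratioAtMost bound) = ratioAtMost λ R →
  eventually-map (λ {M} → ℕ.≤-trans (ℕ.*-monoˡ-≤ R (ℕ.*-monoˡ-≤ q (f≤f′ M)))) (bound R)

atLeast-mono : ∀ {f f′ g p q} → (∀ M → f′ M ≤ f M) → RatioAtLeast f′ g p q → RatioAtLeast f g p q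
atLeast-mono {g = g} {p} {q} f′≤f (ratioAtLeast bound) = ratioAtLeast λ R →
  eventually-map (λ {M} le → ℕ.≤-trans le (ℕ.+-monoˡ-≤ (g M * q) (ℕ.*-monoˡ-≤ R (ℕ.*-monoˡ-≤ q (f′≤f M)))))
                 (bound R)

module _ {f g n : ℕ → ℕ} {p q : ℕ} (n-grows : ∀ D → D ≤ n D) (g∘n≗id : ∀ D → g (n D) ≡ D) where

  atMost-along : RatioAtMost f g p q → RatioAtMost (f ∘ n) id p q
  atMost-along (ratioAtMost bound) = ratioAtMost λ R → let (N , tail) = bound R in
    N , λ D N≤D → subst (λ t → f (n D) * q * R ≤ p * t * R + t * q) (g∘n≗id D)
                        (tail (n D) (ℕ.≤-trans N≤D (n-grows D)))

  atLeast-along : RatioAtLeast f g p q → RatioAtLeast (f ∘ n) id p q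
  atLeast-along (ratioAtLeast bound) = ratioAtLeast λ R → let (N , tail) = bound R in
    N , λ D N≤D → subst (λ t → p * t * R ≤ f (n D) * q * R + t * q) (g∘n≗id D)
                        (tail (n D) (ℕ.≤-trans N≤D (n-grows D)))

private
  linear-bound : ∀ {M G} c e → 0 < c → 0 < e → c * M * (2 * e) ≤ G * e * (2 * e) + M * e → M ≤ 2 * e * G
  linear-bound {M} {G} c e c>0 e>0 h = ℕ.+-cancelʳ-≤ M M (2 * e * G) (ℕ.*-cancelˡ-≤ e (begin
    e * (M + M)               ≤⟨ ℕ.*-monoʳ-≤ e (ℕ.+-mono-≤ (ℕ.m≤n*m M c) (ℕ.m≤n*m M c)) ⟩
    e * (c * M + c * M)       ≡⟨ solve (M ∷ c ∷ e ∷ []) ⟩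
    c * M * (2 * e)           ≤⟨ h ⟩
    G * e * (2 * e) + M * e   ≡⟨ solve (M ∷ G ∷ e ∷ []) ⟩
    e * (2 * e * G + M)       ∎))
    where
    open ℕ.≤-Reasoning
    instance
      _ = ℕ.>-nonZero c>0
      _ = ℕ.>-nonZero e>0

  absorb : ∀ {M G} b c e K S → 0 < b → 0 < c → 0 < e → c * M * (2 * e) ≤ G * e * (2 * e) + M * e →
           2 * e * K < S → M * K ≤ G * (b * c) * S
  absorb {M} {G} b c e K S b>0 c>0 e>0 g-bound K<S = begin
    M * K             ≤⟨ ℕ.*-monoˡ-≤ K (linear-bound {M} {G} c e c>0 e>0 g-bound) ⟩
    2 * e * G * K     ≡⟨ solve (G ∷ e ∷ K ∷ []) ⟩
    G * (2 * e * K)   ≤⟨ ℕ.*-monoʳ-≤ G (ℕ.<⇒≤ K<S) ⟩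
    G * S             ≤⟨ ℕ.*-monoˡ-≤ S (ℕ.m≤m*n G (b * c)) ⟩
    G * (b * c) * S   ∎
    where
    open ℕ.≤-Reasoning
    instance _ = ℕ.>-nonZero (ℕ.*-mono-≤ b>0 c>0)

  ratio-upper-core : ∀ {F G M} a b c e R S → 0 < b → 0 < c → 0 < e → 2 * e * (R * (a * e + c * b)) < S →
    F * b * S ≤ a * M * S + M * b → c * M * S ≤ G * e * S + M * e → c * M * (2 * e) ≤ G * e * (2 * e) + M * e →
    F * (b * c) * R ≤ a * e * G * R + G * (b * c)
  ratio-upper-core {F} {G} {M} a b c e R S b>0 c>0 e>0 S-large hF hG hG′ = ℕ.*-cancelˡ-≤ S (begin
    S * (F * (b * c) * R)                             ≡⟨ solve (F ∷ b ∷ c ∷ R ∷ S ∷ []) ⟩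
    c * R * (F * b * S)                               ≤⟨ ℕ.*-monoʳ-≤ (c * R) hF ⟩
    c * R * (a * M * S + M * b)                       ≡⟨ solve (a ∷ b ∷ c ∷ R ∷ S ∷ M ∷ []) ⟩
    a * R * (c * M * S) + M * (c * R * b)             ≤⟨ ℕ.+-monoˡ-≤ (M * (c * R * b)) (ℕ.*-monoʳ-≤ (a * R) hG) ⟩
    a * R * (G * e * S + M * e) + M * (c * R * b)     ≡⟨ solve (a ∷ b ∷ c ∷ e ∷ R ∷ S ∷ M ∷ G ∷ []) ⟩
    S * (a * e * G * R) + M * (R * (a * e + c * b))
      ≤⟨ ℕ.+-monoʳ-≤ (S * (a * e * G * R)) (absorb {M} {G} b c e _ S b>0 c>0 e>0 hG′ S-large) ⟩
    S * (a * e * G * R) + G * (b * c) * S             ≡⟨ solve (a ∷ b ∷ c ∷ e ∷ R ∷ S ∷ G ∷ []) ⟩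
    S * (a * e * G * R + G * (b * c))                 ∎)
    where
    open ℕ.≤-Reasoning
    instance _ = ℕ.>-nonZero (ℕ.≤-trans (s≤s z≤n) S-large)

  ratio-lower-core : ∀ {F G M} a b c e R S → 0 < b → 0 < c → 0 < e → 2 * e * (R * (a * e + c * b)) < S →
    a * M * S ≤ F * b * S + M * b → G * e * S ≤ c * M * S + M * e → c * M * (2 * e) ≤ G * e * (2 * e) + M * e →
    a * e * G * R ≤ F * (b * c) * R + G * (b * c)
  ratio-lower-core {F} {G} {M} a b c e R S b>0 c>0 e>0 S-large hF hG hG′ = ℕ.*-cancelˡ-≤ S (begin
    S * (a * e * G * R)                               ≡⟨ solve (a ∷ e ∷ G ∷ R ∷ S ∷ []) ⟩
    a * R * (G * e * S)                               ≤⟨ ℕ.*-monoʳ-≤ (a * R) hG ⟩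
    a * R * (c * M * S + M * e)                       ≡⟨ solve (a ∷ c ∷ e ∷ R ∷ S ∷ M ∷ []) ⟩
    c * R * (a * M * S) + M * (R * (a * e))           ≤⟨ ℕ.+-monoˡ-≤ (M * (R * (a * e))) (ℕ.*-monoʳ-≤ (c * R) hF) ⟩
    c * R * (F * b * S + M * b) + M * (R * (a * e))   ≡⟨ solve (a ∷ b ∷ c ∷ e ∷ R ∷ S ∷ M ∷ F ∷ []) ⟩
    S * (F * (b * c) * R) + M * (R * (a * e + c * b))
      ≤⟨ ℕ.+-monoʳ-≤ (S * (F * (b * c) * R)) (absorb {M} {G} b c e _ S b>0 c>0 e>0 hG′ S-large) ⟩
    S * (F * (b * c) * R) + G * (b * c) * S           ≡⟨ solve (b ∷ c ∷ R ∷ S ∷ F ∷ G ∷ []) ⟩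
    S * (F * (b * c) * R + G * (b * c))               ∎)
    where
    open ℕ.≤-Reasoning
    instance _ = ℕ.>-nonZero (ℕ.≤-trans (s≤s z≤n) S-large)

-- The precision S R at which f and g are sampled absorbs the error made in dividing by g.
module _ {f g : ℕ → ℕ} {a b c e : ℕ} (b>0 : 0 < b) (c>0 : 0 < c) (e>0 : 0 < e) where
  private
    S : ℕ → ℕ
    S R = suc (2 * e * (R * (a * e + c * b)))

  atMost-divide : RatioAtMost f id a b → Density g c e → RatioAtMost f g (a * e) (b * c)
  atMost-divide (ratioAtMost f≤) (density _ (ratioAtLeast g≥)) = ratioAtMost λ R →
    eventually-map (λ {M} (hf , hg , hg′) →
                      ratio-upper-core {f M} {g M} a b c e R (S R) b>0 c>0 e>0 ℕ.≤-refl hf hg hg′)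
                   (eventually-zip (f≤ (S R)) (eventually-zip (g≥ (S R)) (g≥ (2 * e))))

  atLeast-divide : RatioAtLeast f id a b → Density g c e → RatioAtLeast f g (a * e) (b * c)
  atLeast-divide (ratioAtLeast f≥) (density (ratioAtMost g≤) (ratioAtLeast g≥)) = ratioAtLeast λ R →
    eventually-map (λ {M} (hf , hg , hg′) →
                      ratio-lower-core {f M} {g M} a b c e R (S R) b>0 c>0 e>0 ℕ.≤-refl hf hg hg′)
                   (eventually-zip (f≥ (S R)) (eventually-zip (g≤ (S R)) (g≥ (2 * e))))

private
  approx-upper-core : ∀ {F G} p q q′ p₀ R → 0 < q′ → p * q * (2 * R) ≤ p₀ * q′ * (2 * R) + q′ * q →
    F * q′ * (2 * R) ≤ p * G * (2 * R) + G * q′ → F * q * R ≤ p₀ * G * R + G * q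
  approx-upper-core {F} {G} p q q′ p₀ R q′>0 close h = ℕ.*-cancelˡ-≤ (2 * q′) (begin
    2 * q′ * (F * q * R)                              ≡⟨ solve (F ∷ q ∷ q′ ∷ R ∷ []) ⟩
    q * (F * q′ * (2 * R))                            ≤⟨ ℕ.*-monoʳ-≤ q h ⟩
    q * (p * G * (2 * R) + G * q′)                    ≡⟨ solve (p ∷ q ∷ q′ ∷ R ∷ G ∷ []) ⟩
    G * (p * q * (2 * R)) + G * q′ * q                ≤⟨ ℕ.+-monoˡ-≤ (G * q′ * q) (ℕ.*-monoʳ-≤ G close) ⟩
    G * (p₀ * q′ * (2 * R) + q′ * q) + G * q′ * q     ≡⟨ solve (p₀ ∷ q ∷ q′ ∷ R ∷ G ∷ []) ⟩
    2 * q′ * (p₀ * G * R + G * q)                     ∎)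
    where
    open ℕ.≤-Reasoning
    instance _ = ℕ.>-nonZero (ℕ.*-mono-≤ (s≤s (z≤n {1})) q′>0)

  approx-lower-core : ∀ {F G} p q q′ p₀ R → 0 < q′ → p₀ * q′ * (2 * R) ≤ p * q * (2 * R) + q′ * q →
    p * G * (2 * R) ≤ F * q′ * (2 * R) + G * q′ → p₀ * G * R ≤ F * q * R + G * q
  approx-lower-core {F} {G} p q q′ p₀ R q′>0 close h = ℕ.*-cancelˡ-≤ (2 * q′) (begin
    2 * q′ * (p₀ * G * R)                             ≡⟨ solve (p₀ ∷ q′ ∷ R ∷ G ∷ []) ⟩
    G * (p₀ * q′ * (2 * R))                           ≤⟨ ℕ.*-monoʳ-≤ G close ⟩
    G * (p * q * (2 * R) + q′ * q)                    ≡⟨ solve (p ∷ q ∷ q′ ∷ R ∷ G ∷ []) ⟩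
    q * (p * G * (2 * R)) + G * q′ * q                ≤⟨ ℕ.+-monoˡ-≤ (G * q′ * q) (ℕ.*-monoʳ-≤ q h) ⟩
    q * (F * q′ * (2 * R) + G * q′) + G * q′ * q      ≡⟨ solve (F ∷ q ∷ q′ ∷ R ∷ G ∷ []) ⟩
    2 * q′ * (F * q * R + G * q)                      ∎)
    where
    open ℕ.≤-Reasoning
    instance _ = ℕ.>-nonZero (ℕ.*-mono-≤ (s≤s (z≤n {1})) q′>0)

atMost-approx : ∀ {f g p₀ q} →
  (∀ R → ∃[ p ] ∃[ q′ ] (0 < q′ × p * q * (2 * R) ≤ p₀ * q′ * (2 * R) + q′ * q × RatioAtMost f g p q′)) →
  RatioAtMost f g p₀ q
atMost-approx {f} {g} {p₀} {q} approx = ratioAtMost λ R →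
  let (p , q′ , q′>0 , close , ratioAtMost bound) = approx R in
  eventually-map (λ {M} → approx-upper-core {f M} {g M} p q q′ p₀ R q′>0 close) (bound (2 * R))

atLeast-approx : ∀ {f g p₀ q} →
  (∀ R → ∃[ p ] ∃[ q′ ] (0 < q′ × p₀ * q′ * (2 * R) ≤ p * q * (2 * R) + q′ * q × RatioAtLeast f g p q′)) →
  RatioAtLeast f g p₀ q
atLeast-approx {f} {g} {p₀} {q} approx = ratioAtLeast λ R →
  let (p , q′ , q′>0 , close , ratioAtLeast bound) = approx R in
  eventually-map (λ {M} → approx-lower-core {f M} {g M} p q q′ p₀ R q′>0 close) (bound (2 * R))

density-id : Density id 1 1
density-id = density (ratioAtMost λ R → 0 , λ M _ → ≤-+ (cong (_* R) (sym (1*M≡M*1 M))))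
                     (ratioAtLeast λ R → 0 , λ M _ → ≤-+ (cong (_* R) (1*M≡M*1 M)))
  where
  ≤-+ : ∀ {x y z} → x ≡ y → x ≤ y + z
  ≤-+ refl = ℕ.m≤m+n _ _
  1*M≡M*1 : ∀ M → 1 * M ≡ M * 1
  1*M≡M*1 M = trans (ℕ.*-identityˡ M) (sym (ℕ.*-identityʳ M))

-- Normality with natural-number error bounds

open import Data.Vec using (Vec; []; _∷_)

private
  ⊖-bound⇒ : ∀ x y R E → x ≤ y → (y ∸ x) * R ≤ E → y * R ≤ x * R + E
  ⊖-bound⇒ x y R E _ h = ℕ.≤-trans (ℕ.m≤n+m∸n (y * R) (x * R))
    (ℕ.+-monoʳ-≤ (x * R) (subst (_≤ E) (ℕ.*-distribʳ-∸ R y x) h))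

  ⊖-bound⇐ : ∀ x y R E → y * R ≤ x * R + E → (y ∸ x) * R ≤ E
  ⊖-bound⇐ x y R E h = subst (_≤ E) (sym (ℕ.*-distribʳ-∸ R y x)) (ℕ.m≤n+o⇒m∸n≤o (y * R) (x * R) h)

  ≤-bound : ∀ x y R E → x ≤ y → x * R ≤ y * R + E
  ≤-bound x y R E x≤y = ℕ.≤-trans (ℕ.*-monoˡ-≤ R x≤y) (ℕ.m≤m+n _ E)

∣⊖∣*≤⇒ : ∀ x y R E → ℤ.∣ x ⊖ y ∣ * R ≤ E → (x * R ≤ y * R + E) × (y * R ≤ x * R + E)
∣⊖∣*≤⇒ x y R E h with ℕ.≤-total x y
... | inj₁ x≤y = ≤-bound x y R E x≤y , ⊖-bound⇒ x y R E x≤y (subst (λ t → t * R ≤ E) (ℤ.∣⊖∣-≤ x≤y) h)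
... | inj₂ y≤x = ⊖-bound⇒ y x R E y≤x
                   (subst (λ t → t * R ≤ E) (trans (ℤ.∣m⊖n∣≡∣n⊖m∣ x y) (ℤ.∣⊖∣-≤ y≤x)) h) ,
                 ≤-bound y x R E y≤x

∣⊖∣*≤⇐ : ∀ x y R E → x * R ≤ y * R + E → y * R ≤ x * R + E → ℤ.∣ x ⊖ y ∣ * R ≤ E
∣⊖∣*≤⇐ x y R E h₁ h₂ with ℕ.≤-total x y
... | inj₁ x≤y = subst (λ t → t * R ≤ E) (sym (ℤ.∣⊖∣-≤ x≤y)) (⊖-bound⇐ x y R E h₂)
... | inj₂ y≤x = subst (λ t → t * R ≤ E) (sym (trans (ℤ.∣m⊖n∣≡∣n⊖m∣ x y) (ℤ.∣⊖∣-≤ y≤x)))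
                       (⊖-bound⇐ y x R E h₁)

private
  toℚᵘ-/ : ∀ i m .{{_ : NonZero m}} → toℚᵘ (i ℚ./ m) ℚᵘ.≃ mkℚᵘ i (ℕ.pred m)
  toℚᵘ-/ i m = *≡* (begin
    ℚᵘ.↥ (toℚᵘ p) ℤ.* ℤ.+ suc (ℕ.pred m) ≡⟨ cong₂ (λ t u → t ℤ.* ℤ.+ u) (ℚ.↥ᵘ-toℚᵘ p) (ℕ.suc-pred m) ⟩
    ℚ.↥ p ℤ.* ℤ.+ m                       ≡⟨ cong (ℚ.↥ p ℤ.*_) (ℚ.↧-/ i m) ⟨
    ℚ.↥ p ℤ.* (ℚ.↧ p ℤ.* g)               ≡⟨ cong (ℚ.↥ p ℤ.*_) (ℤ.*-comm (ℚ.↧ p) g) ⟩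
    ℚ.↥ p ℤ.* (g ℤ.* ℚ.↧ p)               ≡⟨ ℤ.*-assoc (ℚ.↥ p) g (ℚ.↧ p) ⟨
    ℚ.↥ p ℤ.* g ℤ.* ℚ.↧ p                 ≡⟨ cong (ℤ._* ℚ.↧ p) (ℚ.↥-/ i m) ⟩
    i ℤ.* ℚ.↧ p                         ≡⟨ cong (i ℤ.*_) (ℚ.↧ᵘ-toℚᵘ p) ⟨
    i ℤ.* ℚᵘ.↧ (toℚᵘ p)                 ∎)
    where
    open ≡-Reasoning
    p = i ℚ./ m
    g = gcd i (ℤ.+ m)

  toℚᵘ-∣/-/∣ : ∀ c n m .{{_ : NonZero m}} →
    toℚᵘ (ℚ.∣ ℤ.+ c ℚ./ suc n ℚ.- ℤ.+ 1 ℚ./ m ∣) ℚᵘ.≃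
    ℚᵘ.∣ mkℚᵘ (ℤ.+ c) n ℚᵘ.- mkℚᵘ (ℤ.+ 1) (ℕ.pred m) ∣
  toℚᵘ-∣/-/∣ c n m = ℚᵘ.≃-trans (ℚ.toℚᵘ-homo-∣-∣ _) (ℚᵘ.∣-∣-cong
    (ℚᵘ.≃-trans (ℚ.toℚᵘ-homo-+ (ℤ.+ c ℚ./ suc n) _) (ℚᵘ.+-cong (toℚᵘ-/ (ℤ.+ c) (suc n))
      (ℚᵘ.≃-trans (ℚ.toℚᵘ-homo‿- (ℤ.+ 1 ℚ./ m)) (ℚᵘ.-‿cong (toℚᵘ-/ (ℤ.+ 1) m))))))

  numerator : ℕ → ℕ → ℕ → ℤ.ℤ
  numerator c n q = ℤ.+ c ℤ.* ℤ.+ suc q ℤ.+ -[1+ 0 ] ℤ.* ℤ.+ suc n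

  numerator-⊖ : ∀ c n q → numerator c n q ≡ (c * suc q) ⊖ suc n
  numerator-⊖ c n q = trans (cong₂ ℤ._+_ (sym (ℤ.pos-* c (suc q))) (ℤ.-1*i≡-i (ℤ.+ suc n)))
                            (ℤ.m-n≡m⊖n (c * suc q) (suc n))

  ℚᵘ-∣/-1/∣<⇒ : ∀ c n q r → ℚᵘ.∣ mkℚᵘ (ℤ.+ c) n ℚᵘ.- mkℚᵘ (ℤ.+ 1) q ∣ ℚᵘ.< mkℚᵘ (ℤ.+ 1) r →
             ℤ.∣ c * suc q ⊖ suc n ∣ * suc r < suc n * suc q
  ℚᵘ-∣/-1/∣<⇒ c n q r (*<* h) = subst (λ z → ℤ.∣ z ∣ * suc r < suc n * suc q) (numerator-⊖ c n q)
    (ℤ.drop‿+<+ (subst₂ ℤ._<_ (sym (ℤ.pos-* ℤ.∣ numerator c n q ∣ (suc r)))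
                                (ℤ.*-identityˡ (ℤ.+ (suc n * suc q))) h))

  ℚᵘ-∣/-1/∣≤⇐ : ∀ c n q r → ℤ.∣ c * suc q ⊖ suc n ∣ * suc r ≤ suc n * suc q →
             ℚᵘ.∣ mkℚᵘ (ℤ.+ c) n ℚᵘ.- mkℚᵘ (ℤ.+ 1) q ∣ ℚᵘ.≤ mkℚᵘ (ℤ.+ 1) r
  ℚᵘ-∣/-1/∣≤⇐ c n q r h = *≤* (subst₂ ℤ._≤_ (ℤ.pos-* ℤ.∣ numerator c n q ∣ (suc r))
                                              (sym (ℤ.*-identityˡ (ℤ.+ (suc n * suc q))))
    (ℤ.+≤+ (subst (λ z → ℤ.∣ z ∣ * suc r ≤ suc n * suc q) (sym (numerator-⊖ c n q)) h)))

∣/-1/∣<⇒ : ∀ c n q r .{{_ : NonZero q}} → ℚ.∣ ℤ.+ c ℚ./ suc n ℚ.- ℤ.+ 1 ℚ./ q ∣ ℚ.< ℤ.+ 1 ℚ./ suc r →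
           ℤ.∣ c * q ⊖ suc n ∣ * suc r < suc n * q
∣/-1/∣<⇒ c n q r h = subst (λ t → ℤ.∣ c * t ⊖ suc n ∣ * suc r < suc n * t) (ℕ.suc-pred q)
  (ℚᵘ-∣/-1/∣<⇒ c n (ℕ.pred q) r
    (ℚᵘ.<-respʳ-≃ (toℚᵘ-/ (ℤ.+ 1) (suc r)) (ℚᵘ.<-respˡ-≃ (toℚᵘ-∣/-/∣ c n q) (ℚ.toℚᵘ-mono-< h))))

∣/-1/∣≤⇐ : ∀ c n q r .{{_ : NonZero q}} → ℤ.∣ c * q ⊖ suc n ∣ * suc r ≤ suc n * q →
           ℚ.∣ ℤ.+ c ℚ./ suc n ℚ.- ℤ.+ 1 ℚ./ q ∣ ℚ.≤ ℤ.+ 1 ℚ./ suc r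
∣/-1/∣≤⇐ c n q r h = ℚ.toℚᵘ-cancel-≤ (ℚᵘ.≤-respʳ-≃ (ℚᵘ.≃-sym (toℚᵘ-/ (ℤ.+ 1) (suc r)))
  (ℚᵘ.≤-respˡ-≃ (ℚᵘ.≃-sym (toℚᵘ-∣/-/∣ c n q)) (ℚᵘ-∣/-1/∣≤⇐ c n (ℕ.pred q) r
    (subst (λ t → ℤ.∣ c * t ⊖ suc n ∣ * suc r ≤ suc n * t) (sym (ℕ.suc-pred q)) h))))

1/suc<ε : ∀ ε → 0ℚ ℚ.< ε → ∃[ r ] (ℤ.+ 1 ℚ./ suc r ℚ.< ε)
1/suc<ε ε 0<ε = go ε (ℚ.positive 0<ε)
  where
  go : ∀ ε → ℚ.Positive ε → ∃[ r ] (ℤ.+ 1 ℚ./ suc r ℚ.< ε)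
  go (mkℚ +[1+ p ] d _) _ =
    suc d , ℚ.toℚᵘ-cancel-< (ℚᵘ.<-respˡ-≃ (ℚᵘ.≃-sym (toℚᵘ-/ (ℤ.+ 1) (suc (suc d))))
      (*<* (subst₂ ℤ._<_ (sym (ℤ.*-identityˡ (ℤ.+ suc d))) (sym (ℤ.pos-* (suc p) (suc (suc d))))
        (ℤ.+<+ (ℕ.<-≤-trans (ℕ.n<1+n (suc d)) (ℕ.m≤n*m (suc (suc d)) (suc p)))))))

module _ (B : ℕ) .{{_ : NonZero B}} (d : Digits B) where

  normal⇒density : Normal B d → ∀ k (c : Vec (Fin B) k) → Density (count d c) 1 (B ^ k)
  normal⇒density normal k c = density (ratioAtMost λ R → eventually-map proj₁ (close R))
                                      (ratioAtLeast λ R → eventually-map proj₂ (close R))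
    where
    instance _ = ℕ.m^n≢0 B k
    q = B ^ k
    Close : ℕ → ℕ → Set
    Close R M = (count d c M * q * R ≤ 1 * M * R + M * q) × (1 * M * R ≤ count d c M * q * R + M * q)
    close : ∀ R → Eventually (Close R)
    close zero = 0 , λ M _ → subst (_≤ 1 * M * 0 + M * q) (sym (ℕ.*-zeroʳ (count d c M * q))) z≤n ,
                             subst (_≤ count d c M * q * 0 + M * q) (sym (ℕ.*-zeroʳ (1 * M))) z≤n
    close (suc r) with normal k c (ℤ.+ 1 ℚ./ suc r) (ℚ.positive⁻¹ _ {{ℚ.normalize-pos 1 (suc r)}})
    ... | N , tail = suc N , near
      where
      near : ∀ M → suc N ≤ M → Close (suc r) M
      near (suc M) (s≤s N≤M) =
        let (h₁ , h₂) = ∣⊖∣*≤⇒ (count d c (suc M) * q) (suc M) (suc r) (suc M * q)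
                          (ℕ.<⇒≤ (∣/-1/∣<⇒ (count d c (suc M)) M q r (tail (suc M) (ℕ.m≤n⇒m≤1+n N≤M))))
        in subst (λ t → count d c (suc M) * q * suc r ≤ t * suc r + suc M * q) (sym (ℕ.*-identityˡ (suc M))) h₁ ,
           subst (λ t → t * suc r ≤ count d c (suc M) * q * suc r + suc M * q) (sym (ℕ.*-identityˡ (suc M))) h₂

  density⇒normal : (∀ k (c : Vec (Fin B) k) → Density (count d c) 1 (B ^ k)) → Normal B d
  density⇒normal dens k c ε 0<ε with 1/suc<ε ε 0<ε | dens k c
  ... | r , 1/r<ε | density (ratioAtMost upper) (ratioAtLeast lower)
      with eventually-zip (upper (suc r)) (lower (suc r))
  ... | N , tail = suc N , bound
    where
    instance _ = ℕ.m^n≢0 B k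
    bound : ∀ n .{{_ : NonZero n}} → suc N ≤ n → ℚ.∣ ℤ.+ count d c n ℚ./ n ℚ.- ℤ.+ 1 ℚ./ B ^ k ∣ ℚ.< ε
    bound (suc M) (s≤s N≤M) =
      let (h₁ , h₂) = tail (suc M) (ℕ.m≤n⇒m≤1+n N≤M)
          one* = ℕ.*-identityˡ (suc M)
      in ℚ.≤-<-trans (∣/-1/∣≤⇐ (count d c (suc M)) M (B ^ k) r
           (∣⊖∣*≤⇐ (count d c (suc M) * B ^ k) (suc M) (suc r) (suc M * B ^ k)
             (subst (λ t → count d c (suc M) * B ^ k * suc r ≤ t * suc r + suc M * B ^ k) one* h₁)
             (subst (λ t → t * suc r ≤ count d c (suc M) * B ^ k * suc r + suc M * B ^ k) one* h₂)))
         1/r<ε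

-- Words and windows

∑Words : ∀ {B} L → (Vec (Fin B) L → ℕ) → ℕ
∑Words         zero    φ = φ []
∑Words {B} (suc L) φ = ∑[ x < B ] ∑Words L (λ w → φ (x ∷ w))

∑Words-cong : ∀ {B} L {φ ψ : Vec (Fin B) L → ℕ} → φ ≗ ψ → ∑Words L φ ≡ ∑Words L ψ
∑Words-cong zero    eq = eq []
∑Words-cong {B} (suc L) eq = sum-cong-≗ {B} λ x → ∑Words-cong L (λ w → eq (x ∷ w))

∑Words-*ˡ : ∀ {B} L c (φ : Vec (Fin B) L → ℕ) → ∑Words L (λ w → c * φ w) ≡ c * ∑Words L φ
∑Words-*ˡ zero    c φ = refl
∑Words-*ˡ {B} (suc L) c φ = trans (sum-cong-≗ {B} λ x → ∑Words-*ˡ L c (λ w → φ (x ∷ w)))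
                                  (sym (*-distribˡ-sum c λ x → ∑Words L (λ w → φ (x ∷ w))))

∑Words-const : ∀ {B} L x → ∑Words {B} L (λ _ → x) ≡ B ^ L * x
∑Words-const         zero    x = sym (ℕ.*-identityˡ x)
∑Words-const {B} (suc L) x = begin
  ∑[ y < B ] ∑Words {B} L (λ _ → x) ≡⟨ sum-cong-≗ {B} (λ _ → ∑Words-const L x) ⟩
  ∑[ y < B ] (B ^ L * x)            ≡⟨ ∑-const B (B ^ L * x) ⟩
  B * (B ^ L * x)                   ≡⟨ ℕ.*-assoc B (B ^ L) x ⟨
  B ^ suc L * x                     ∎
  where open ≡-Reasoning

∑Words-𝟙∧ : ∀ {B} L x (f : Vec (Fin B) L → Bool) →
            ∑Words L (λ w → 𝟙 (x ∧ f w)) ≡ 𝟙 x * ∑Words L (𝟙 ∘ f)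
∑Words-𝟙∧ L x f = trans (∑Words-cong L λ w → 𝟙-∧ x (f w)) (∑Words-*ˡ L (𝟙 x) (𝟙 ∘ f))

∑Words-+ : ∀ {B} L (φ ψ : Vec (Fin B) L → ℕ) → ∑Words L (λ w → φ w + ψ w) ≡ ∑Words L φ + ∑Words L ψ
∑Words-+         zero    φ ψ = refl
∑Words-+ {B} (suc L) φ ψ =
  trans (sum-cong-≗ {B} λ x → ∑Words-+ L (λ w → φ (x ∷ w)) (λ w → ψ (x ∷ w)))
        (∑-distrib-+ (λ x → ∑Words L (λ w → φ (x ∷ w))) (λ x → ∑Words L (λ w → ψ (x ∷ w))))

density-∑Words : ∀ {B q} L (F : Vec (Fin B) L → ℕ → ℕ) (P : Vec (Fin B) L → ℕ) →
                 (∀ w → Density (F w) (P w) q) → Density (λ M → ∑Words L (λ w → F w M)) (∑Words L P) q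
density-∑Words zero    F P dens = dens []
density-∑Words (suc L) F P dens = density-∑ _ _ λ x →
  density-∑Words L (λ w → F (x ∷ w)) (λ w → P (x ∷ w)) (λ w → dens (x ∷ w))

sumUpTo : (ℕ → ℕ) → ℕ → ℕ
sumUpTo f zero    = 0
sumUpTo f (suc M) = sumUpTo f M + f M

sumUpTo-mono-≤ : ∀ {f g} → (∀ m → f m ≤ g m) → ∀ M → sumUpTo f M ≤ sumUpTo g M
sumUpTo-mono-≤ f≤g zero    = z≤n
sumUpTo-mono-≤ f≤g (suc M) = ℕ.+-mono-≤ (sumUpTo-mono-≤ f≤g M) (f≤g M)

sumUpTo-+ : ∀ f g M → sumUpTo (λ m → f m + g m) M ≡ sumUpTo f M + sumUpTo g M
sumUpTo-+ f g zero    = refl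
sumUpTo-+ f g (suc M) = trans (cong (_+ (f M + g M)) (sumUpTo-+ f g M))
                              (interchange (sumUpTo f M) (sumUpTo g M) (f M) (g M))
  where
  interchange : ∀ a b c d → (a + b) + (c + d) ≡ (a + c) + (b + d)
  interchange = solve-∀

module _ {B : ℕ} (a : Digits B) where

  window : ℕ → (L : ℕ) → Vec (Fin B) L
  window m zero    = []
  window m (suc L) = a m ∷ window (suc m) L

  windowSum : ∀ {L} → (Vec (Fin B) L → ℕ) → ℕ → ℕ
  windowSum {L} φ = sumUpTo (λ m → φ (window m L))

  ∑Words-matchAt : ∀ L (φ : Vec (Fin B) L → ℕ) m → ∑Words L (λ w → φ w * 𝟙 (matchAt a m w)) ≡ φ (window m L)
  ∑Words-matchAt zero    φ m = ℕ.*-identityʳ (φ [])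
  ∑Words-matchAt (suc L) φ m = begin
    ∑[ x < B ] ∑Words L (λ w → φ (x ∷ w) * 𝟙 (⌊ a m Fin.≟ x ⌋ ∧ matchAt a (suc m) w))
      ≡⟨ sum-cong-≗ {B} (λ x → ∑Words-cong L λ w → trans (cong (φ (x ∷ w) *_) (𝟙-∧ ⌊ a m Fin.≟ x ⌋ _))
                                                          (swap (φ (x ∷ w)) (𝟙 ⌊ a m Fin.≟ x ⌋) _)) ⟩
    ∑[ x < B ] ∑Words L (λ w → 𝟙 ⌊ a m Fin.≟ x ⌋ * (φ (x ∷ w) * 𝟙 (matchAt a (suc m) w)))
      ≡⟨ sum-cong-≗ {B} (λ x → ∑Words-*ˡ L (𝟙 ⌊ a m Fin.≟ x ⌋) _) ⟩
    ∑[ x < B ] (𝟙 ⌊ a m Fin.≟ x ⌋ * ∑Words L (λ w → φ (x ∷ w) * 𝟙 (matchAt a (suc m) w)))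
      ≡⟨ ∑-δ (a m) (λ x → ∑Words L (λ w → φ (x ∷ w) * 𝟙 (matchAt a (suc m) w))) ⟩
    ∑Words L (λ w → φ (a m ∷ w) * 𝟙 (matchAt a (suc m) w))
      ≡⟨ ∑Words-matchAt L (λ w → φ (a m ∷ w)) (suc m) ⟩
    φ (window m (suc L))
      ∎
    where
    open ≡-Reasoning
    swap : ∀ x y z → x * (y * z) ≡ y * (x * z)
    swap = solve-∀

  windowSum≡∑Words : ∀ L (φ : Vec (Fin B) L → ℕ) → windowSum φ ≗ (λ M → ∑Words L (λ w → φ w * count a w M))
  windowSum≡∑Words L φ zero    = sym (begin
    ∑Words L (λ w → φ w * 0) ≡⟨ ∑Words-cong L (λ w → ℕ.*-zeroʳ (φ w)) ⟩
    ∑Words L (λ _ → 0)       ≡⟨ ∑Words-const L 0 ⟩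
    B ^ L * 0                ≡⟨ ℕ.*-zeroʳ (B ^ L) ⟩
    0                        ∎)
    where open ≡-Reasoning
  windowSum≡∑Words L φ (suc M) = begin
    windowSum φ M + φ (window M L)
      ≡⟨ cong₂ _+_ (windowSum≡∑Words L φ M) (sym (∑Words-matchAt L φ M)) ⟩
    ∑Words L (λ w → φ w * count a w M) + ∑Words L (λ w → φ w * 𝟙 (matchAt a M w))
      ≡⟨ ∑Words-+ L _ _ ⟨
    ∑Words L (λ w → φ w * count a w M + φ w * 𝟙 (matchAt a M w))
      ≡⟨ ∑Words-cong L (λ w → ℕ.*-distribˡ-+ (φ w) (count a w M) _) ⟨
    ∑Words L (λ w → φ w * (count a w M + 𝟙 (matchAt a M w)))
      ∎
    where open ≡-Reasoning

  density-windowSum : ∀ L → (∀ (w : Vec (Fin B) L) → Density (count a w) 1 (B ^ L)) →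
                      ∀ φ → Density (windowSum φ) (∑Words L φ) (B ^ L)
  density-windowSum L dens φ =
    density-cong (λ M → sym (windowSum≡∑Words L φ M)) (∑Words-cong L λ w → ℕ.*-identityʳ (φ w))
      (density-∑Words L (λ w M → φ w * count a w M) (λ w → φ w * 1) (λ w → density-* (φ w) (dens w)))

count-[] : ∀ {B} (d : Digits B) → count d [] ≗ id
count-[] d zero    = refl
count-[] d (suc M) = trans (cong (_+ 1) (count-[] d M)) (ℕ.+-comm M 1)

-- Kept digits

-- The top digit s is dropped; the other digits are read as digits in base s.
keepDigit : ∀ {s} → Fin (suc s) → Maybe (Fin s)
keepDigit {zero}  zero    = nothing
keepDigit {suc s} zero    = just zero
keepDigit {suc s} (suc x) = Maybe.map suc (keepDigit x)

keepDigit-toℕ : ∀ {s} (x : Fin (suc s)) (e : Fin s) → toℕ x ≡ toℕ e → keepDigit x ≡ just e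
keepDigit-toℕ {suc s} zero    zero    _  = refl
keepDigit-toℕ {suc s} (suc x) (suc e) eq = cong (Maybe.map suc) (keepDigit-toℕ x e (ℕ.suc-injective eq))

keepDigit-just⇒< : ∀ {s} (x : Fin (suc s)) {e} → keepDigit x ≡ just e → toℕ x < s
keepDigit-just⇒< {suc s} zero    _  = s≤s z≤n
keepDigit-just⇒< {suc s} (suc x) eq with keepDigit x in eq′
... | just _ = s≤s (keepDigit-just⇒< x eq′)

∑-keepDigit : ∀ {s} (g : Maybe (Fin s) → ℕ) →
              ∑[ x < suc s ] g (keepDigit x) ≡ ∑[ e < s ] g (just e) + g nothing
∑-keepDigit {zero}  g = ℕ.+-identityʳ (g nothing)
∑-keepDigit {suc s} g = trans (cong (g (just zero) +_) (∑-keepDigit (g ∘ Maybe.map suc)))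
                              (sym (ℕ.+-assoc (g (just zero)) _ (g nothing)))

≤-^ : ∀ {m} → 2 ≤ m → ∀ L → L ≤ m ^ L
≤-^ {m} 2≤m zero    = z≤n
≤-^ {m} 2≤m (suc L) = begin
  suc L             ≤⟨ s≤s (≤-^ 2≤m L) ⟩
  1 + m ^ L         ≤⟨ ℕ.+-monoˡ-≤ (m ^ L) (ℕ.m^n>0 m L) ⟩
  m ^ L + m ^ L     ≡⟨ cong (m ^ L +_) (ℕ.+-identityʳ (m ^ L)) ⟨
  2 * m ^ L         ≤⟨ ℕ.*-monoˡ-≤ (m ^ L) 2≤m ⟩
  m * m ^ L         ∎
  where
  open ℕ.≤-Reasoning
  instance _ = ℕ.>-nonZero (ℕ.≤-trans (s≤s z≤n) 2≤m)

module KeptDigits (s : ℕ) where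

  Word : ℕ → Set
  Word = Vec (Fin (suc s))

  keptStartsWith : ∀ {k L} → Vec (Fin s) k → Word L → Bool
  keptStartsWith []      w       = true
  keptStartsWith (e ∷ c) []      = false
  keptStartsWith (e ∷ c) (x ∷ w) =
    maybe′ (λ x′ → ⌊ x′ Fin.≟ e ⌋ ∧ keptStartsWith c w) (keptStartsWith (e ∷ c) w) (keepDigit x)

  keptFewerThan : ∀ {L} → ℕ → Word L → Bool
  keptFewerThan zero    w       = false
  keptFewerThan (suc k) []      = true
  keptFewerThan (suc k) (x ∷ w) =
    maybe′ (λ _ → keptFewerThan k w) (keptFewerThan (suc k) w) (keepDigit x)

  #keptStartsWith : ∀ {k} → Vec (Fin s) k → ℕ → ℕ
  #keptStartsWith c L = ∑Words L (𝟙 ∘ keptStartsWith c)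

  #keptFewerThan : ℕ → ℕ → ℕ
  #keptFewerThan k L = ∑Words {suc s} L (𝟙 ∘ keptFewerThan k)

  ∑-keptStartsWith-head : ∀ L {k} e (c : Vec (Fin s) k) →
    ∑[ x < s ] ∑Words L (λ w → 𝟙 (⌊ x Fin.≟ e ⌋ ∧ keptStartsWith c w)) ≡ #keptStartsWith c L
  ∑-keptStartsWith-head L e c = begin
    ∑[ x < s ] ∑Words L (λ w → 𝟙 (⌊ x Fin.≟ e ⌋ ∧ keptStartsWith c w))
      ≡⟨ sum-cong-≗ {s} (λ x → ∑Words-𝟙∧ L ⌊ x Fin.≟ e ⌋ (keptStartsWith c)) ⟩
    ∑[ x < s ] (𝟙 ⌊ x Fin.≟ e ⌋ * #keptStartsWith c L)
      ≡⟨ sum-cong-≗ {s} (λ x → cong (λ t → 𝟙 t * #keptStartsWith c L) (≟-sym x e)) ⟩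
    ∑[ x < s ] (𝟙 ⌊ e Fin.≟ x ⌋ * #keptStartsWith c L)
      ≡⟨ ∑-δ e (λ _ → #keptStartsWith c L) ⟩
    #keptStartsWith c L ∎
    where open ≡-Reasoning

  #keptStartsWith-∷ : ∀ L {k} e (c : Vec (Fin s) k) →
    #keptStartsWith (e ∷ c) (suc L) ≡ #keptStartsWith c L + #keptStartsWith (e ∷ c) L
  #keptStartsWith-∷ L e c =
    trans (∑-keepDigit {s} (λ m → ∑Words L λ w → 𝟙 (maybe′ (λ x′ → ⌊ x′ Fin.≟ e ⌋ ∧ keptStartsWith c w)
                                                             (keptStartsWith (e ∷ c) w) m)))
          (cong (_+ #keptStartsWith (e ∷ c) L) (∑-keptStartsWith-head L e c))

  #keptFewerThan-suc : ∀ L k →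
    #keptFewerThan (suc k) (suc L) ≡ s * #keptFewerThan k L + #keptFewerThan (suc k) L
  #keptFewerThan-suc L k =
    trans (∑-keepDigit {s} (λ m → ∑Words {suc s} L λ w → 𝟙 (maybe′ (λ _ → keptFewerThan k w)
                                                         (keptFewerThan (suc k) w) m)))
          (cong (_+ #keptFewerThan (suc k) L) (∑-const s (#keptFewerThan k L)))

  #keptFewerThan-zero : ∀ L → #keptFewerThan 0 L ≡ 0
  #keptFewerThan-zero L = trans (∑Words-const {suc s} L 0) (ℕ.*-zeroʳ (suc s ^ L))

  #keptFewerThan-one : ∀ L → #keptFewerThan 1 L ≡ 1
  #keptFewerThan-one zero    = refl
  #keptFewerThan-one (suc L) = begin
    #keptFewerThan 1 (suc L)                       ≡⟨ #keptFewerThan-suc L 0 ⟩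
    s * #keptFewerThan 0 L + #keptFewerThan 1 L
      ≡⟨ cong₂ (λ t u → s * t + u) (#keptFewerThan-zero L) (#keptFewerThan-one L) ⟩
    s * 0 + 1                                      ≡⟨ cong (_+ 1) (ℕ.*-zeroʳ s) ⟩
    1                                              ∎
    where open ≡-Reasoning

  -- A word with at least k kept digits is classified by its first k kept digits.
  #kept-partition : ∀ L {k} (c : Vec (Fin s) k) →
                    s ^ k * #keptStartsWith c L + #keptFewerThan k L ≡ suc s ^ L
  #kept-partition L [] = begin
    1 * ∑Words L (λ _ → 1) + #keptFewerThan 0 L ≡⟨ cong₂ _+_ (ℕ.*-identityˡ _) (#keptFewerThan-zero L) ⟩
    ∑Words L (λ _ → 1) + 0                      ≡⟨ ℕ.+-identityʳ _ ⟩
    ∑Words L (λ _ → 1)                          ≡⟨ ∑Words-const L 1 ⟩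
    suc s ^ L * 1                               ≡⟨ ℕ.*-identityʳ _ ⟩
    suc s ^ L                                   ∎
    where open ≡-Reasoning
  #kept-partition zero    {suc k} (e ∷ c) = cong (_+ 1) (ℕ.*-zeroʳ (s ^ suc k))
  #kept-partition (suc L) {suc k} (e ∷ c) = begin
    s ^ suc k * #keptStartsWith (e ∷ c) (suc L) + #keptFewerThan (suc k) (suc L)
      ≡⟨ cong₂ (λ u v → s ^ suc k * u + v) (#keptStartsWith-∷ L e c) (#keptFewerThan-suc L k) ⟩
    s * s ^ k * (F₂ + F₁) + (s * T₂ + T₁)
      ≡⟨ regroup s (s ^ k) F₁ F₂ T₁ T₂ ⟩
    (s ^ suc k * F₁ + T₁) + s * (s ^ k * F₂ + T₂)
      ≡⟨ cong₂ (λ u v → u + s * v) (#kept-partition L (e ∷ c)) (#kept-partition L c) ⟩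
    suc s ^ suc L
      ∎
    where
    open ≡-Reasoning
    F₁ = #keptStartsWith (e ∷ c) L
    F₂ = #keptStartsWith c L
    T₁ = #keptFewerThan (suc k) L
    T₂ = #keptFewerThan k L
    regroup : ∀ s X F₁ F₂ T₁ T₂ → s * X * (F₂ + F₁) + (s * T₂ + T₁) ≡ (s * X * F₁ + T₁) + s * (X * F₂ + T₂)
    regroup = solve-∀

  #keptFewerThan-≤ : ∀ k L → #keptFewerThan k L ≤ suc s ^ L
  #keptFewerThan-≤ zero    L       = ℕ.≤-trans (ℕ.≤-reflexive (#keptFewerThan-zero L)) z≤n
  #keptFewerThan-≤ (suc k) zero    = ℕ.≤-refl
  #keptFewerThan-≤ (suc k) (suc L) = begin
    #keptFewerThan (suc k) (suc L)               ≡⟨ #keptFewerThan-suc L k ⟩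
    s * #keptFewerThan k L + #keptFewerThan (suc k) L
      ≤⟨ ℕ.+-mono-≤ (ℕ.*-monoʳ-≤ s (#keptFewerThan-≤ k L)) (#keptFewerThan-≤ (suc k) L) ⟩
    s * suc s ^ L + suc s ^ L                    ≡⟨ ℕ.+-comm (s * suc s ^ L) _ ⟩
    suc s ^ suc L                                ∎
    where open ℕ.≤-Reasoning

  #keptFewerThan-split : ∀ L₁ k L₂ →
    #keptFewerThan (suc k) (L₁ + L₂) ≤ #keptFewerThan k L₁ * suc s ^ L₂ + suc s ^ L₁
  #keptFewerThan-split zero    zero    L₂ = ℕ.≤-reflexive (#keptFewerThan-one L₂)
  #keptFewerThan-split zero    (suc k) L₂ = begin
    #keptFewerThan (suc (suc k)) L₂ ≤⟨ #keptFewerThan-≤ (suc (suc k)) L₂ ⟩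
    suc s ^ L₂                      ≡⟨ ℕ.*-identityˡ _ ⟨
    1 * suc s ^ L₂                  ≤⟨ ℕ.m≤m+n _ 1 ⟩
    1 * suc s ^ L₂ + 1              ∎
    where open ℕ.≤-Reasoning
  #keptFewerThan-split (suc L₁) zero    L₂ = begin
    #keptFewerThan 1 (suc L₁ + L₂)                            ≡⟨ #keptFewerThan-one (suc L₁ + L₂) ⟩
    1                                                         ≤⟨ ℕ.m^n>0 (suc s) (suc L₁) ⟩
    suc s ^ suc L₁                                            ≤⟨ ℕ.m≤n+m _ (#keptFewerThan 0 (suc L₁) * suc s ^ L₂) ⟩
    #keptFewerThan 0 (suc L₁) * suc s ^ L₂ + suc s ^ suc L₁  ∎
    where open ℕ.≤-Reasoning
  #keptFewerThan-split (suc L₁) (suc k) L₂ = begin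
    #keptFewerThan (suc (suc k)) (suc (L₁ + L₂))
      ≡⟨ #keptFewerThan-suc (L₁ + L₂) (suc k) ⟩
    s * #keptFewerThan (suc k) (L₁ + L₂) + #keptFewerThan (suc (suc k)) (L₁ + L₂)
      ≤⟨ ℕ.+-mono-≤ (ℕ.*-monoʳ-≤ s (#keptFewerThan-split L₁ k L₂)) (#keptFewerThan-split L₁ (suc k) L₂) ⟩
    s * (T₂ * P₂ + P₁) + (T₁ * P₂ + P₁)
      ≡⟨ regroup s T₁ T₂ P₁ P₂ ⟩
    (s * T₂ + T₁) * P₂ + (P₁ + s * P₁)
      ≡⟨ cong (λ t → t * P₂ + (P₁ + s * P₁)) (#keptFewerThan-suc L₁ k) ⟨
    #keptFewerThan (suc k) (suc L₁) * P₂ + suc s ^ suc L₁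
      ∎
    where
    open ℕ.≤-Reasoning
    T₁ = #keptFewerThan (suc k) L₁
    T₂ = #keptFewerThan k L₁
    P₁ = suc s ^ L₁
    P₂ = suc s ^ L₂
    regroup : ∀ s T₁ T₂ P₁ P₂ → s * (T₂ * P₂ + P₁) + (T₁ * P₂ + P₁) ≡ (s * T₂ + T₁) * P₂ + (P₁ + s * P₁)
    regroup = solve-∀

  #keptFewerThan-small : 1 ≤ s → ∀ k R → ∃[ L ] (R * #keptFewerThan k L ≤ suc s ^ L)
  #keptFewerThan-small 1≤s zero    R = 0 , ℕ.≤-trans (ℕ.≤-reflexive (ℕ.*-zeroʳ R)) z≤n
  #keptFewerThan-small 1≤s (suc k) R with #keptFewerThan-small 1≤s k (2 * R)
  ... | L₁ , small = L₁ + 2 * R , ℕ.*-cancelˡ-≤ 2 (begin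
    2 * (R * #keptFewerThan (suc k) (L₁ + 2 * R))  ≡⟨ ℕ.*-assoc 2 R _ ⟨
    2 * R * #keptFewerThan (suc k) (L₁ + 2 * R)    ≤⟨ ℕ.*-monoʳ-≤ (2 * R) (#keptFewerThan-split L₁ k (2 * R)) ⟩
    2 * R * (#keptFewerThan k L₁ * P₂ + P₁)        ≡⟨ ℕ.*-distribˡ-+ (2 * R) _ P₁ ⟩
    2 * R * (#keptFewerThan k L₁ * P₂) + 2 * R * P₁
      ≡⟨ cong (_+ 2 * R * P₁) (ℕ.*-assoc (2 * R) _ P₂) ⟨
    2 * R * #keptFewerThan k L₁ * P₂ + 2 * R * P₁
      ≤⟨ ℕ.+-mono-≤ (ℕ.*-monoˡ-≤ P₂ small) (ℕ.*-monoˡ-≤ P₁ (≤-^ (s≤s 1≤s) (2 * R))) ⟩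
    P₁ * P₂ + P₂ * P₁                              ≡⟨ cong (P₁ * P₂ +_) (ℕ.*-comm P₂ P₁) ⟩
    P₁ * P₂ + P₁ * P₂                              ≡⟨ cong (P₁ * P₂ +_) (ℕ.+-identityʳ (P₁ * P₂)) ⟨
    2 * (P₁ * P₂)                                  ≡⟨ cong (2 *_) (ℕ.^-distribˡ-+-* (suc s) L₁ (2 * R)) ⟨
    2 * suc s ^ (L₁ + 2 * R)                       ∎)
    where
    open ℕ.≤-Reasoning
    P₁ = suc s ^ L₁
    P₂ = suc s ^ (2 * R)

  keptAt : Word 1 → ℕ
  keptAt (x ∷ []) = 𝟙 (is-just (keepDigit x))

  startsAtKept : ∀ {k L} → Vec (Fin s) k → Word (suc L) → ℕ
  startsAtKept c (x ∷ w) = 𝟙 (is-just (keepDigit x) ∧ keptStartsWith c (x ∷ w))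

  fewerAtKept : ∀ {L} → ℕ → Word (suc L) → ℕ
  fewerAtKept k (x ∷ w) = 𝟙 (is-just (keepDigit x) ∧ keptFewerThan k (x ∷ w))

  ∑Words-keptAt : ∑Words 1 keptAt ≡ s
  ∑Words-keptAt = trans (∑-keepDigit {s} (𝟙 ∘ is-just))
                        (trans (ℕ.+-identityʳ _) (trans (∑-const s 1) (ℕ.*-identityʳ s)))

  ∑Words-startsAtKept : ∀ L {k} e (c : Vec (Fin s) k) → ∑Words (suc L) (startsAtKept (e ∷ c)) ≡ #keptStartsWith c L
  ∑Words-startsAtKept L e c = begin
    ∑Words (suc L) (startsAtKept (e ∷ c))
      ≡⟨ ∑-keepDigit {s} (λ m → ∑Words L λ w → 𝟙 (is-just m ∧ maybe′ (λ x′ → ⌊ x′ Fin.≟ e ⌋ ∧ keptStartsWith c w)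
                                                                        (keptStartsWith (e ∷ c) w) m)) ⟩
    ∑[ x < s ] ∑Words L (λ w → 𝟙 (⌊ x Fin.≟ e ⌋ ∧ keptStartsWith c w)) + ∑Words L (λ _ → 0)
      ≡⟨ cong₂ _+_ (∑-keptStartsWith-head L e c) (trans (∑Words-const {suc s} L 0) (ℕ.*-zeroʳ (suc s ^ L))) ⟩
    #keptStartsWith c L + 0
      ≡⟨ ℕ.+-identityʳ _ ⟩
    #keptStartsWith c L ∎
    where open ≡-Reasoning

  ∑Words-fewerAtKept : ∀ L k → ∑Words (suc L) (fewerAtKept (suc k)) ≡ s * #keptFewerThan k L
  ∑Words-fewerAtKept L k = begin
    ∑Words (suc L) (fewerAtKept (suc k))
      ≡⟨ ∑-keepDigit {s} (λ m → ∑Words L λ w → 𝟙 (is-just m ∧ maybe′ (λ _ → keptFewerThan k w)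
                                                                        (keptFewerThan (suc k) w) m)) ⟩
    ∑[ x < s ] #keptFewerThan k L + ∑Words L (λ _ → 0)
      ≡⟨ cong₂ _+_ (∑-const s _) (trans (∑Words-const {suc s} L 0) (ℕ.*-zeroʳ (suc s ^ L))) ⟩
    s * #keptFewerThan k L + 0
      ≡⟨ ℕ.+-identityʳ _ ⟩
    s * #keptFewerThan k L ∎
    where open ≡-Reasoning

-- The subsequence of kept digits

module StrictlyIncreasing {n : ℕ → ℕ} (n-increasing : ∀ i → n i < n (suc i)) where

  n-mono-< : ∀ {i j} → i < j → n i < n j
  n-mono-< {i} {suc j} (s≤s i≤j) with ℕ.m≤n⇒m<n∨m≡n i≤j
  ... | inj₁ i<j  = ℕ.<-trans (n-mono-< i<j) (n-increasing j)
  ... | inj₂ refl = n-increasing i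

  n-cancel-< : ∀ {i j} → n i < n j → i < j
  n-cancel-< {i} {j} ni<nj with ℕ.<-cmp i j
  ... | tri< i<j _ _ = i<j
  ... | tri≈ _ refl _ = contradiction ni<nj (ℕ.<-irrefl refl)
  ... | tri> _ _ j<i = contradiction (n-mono-< j<i) (ℕ.<-asym ni<nj)

  n-grows : ∀ i → i ≤ n i
  n-grows zero    = z≤n
  n-grows (suc i) = ℕ.≤-<-trans (n-grows i) (n-increasing i)

module Subsequence {s : ℕ} (a : Digits (suc s)) (d : Digits s) (n : ℕ → ℕ)
  (n-increasing : ∀ i → n i < n (suc i))
  (keep-a∘n : ∀ i → keepDigit (a (n i)) ≡ just (d i))
  (kept⇒∈n : ∀ m {e} → keepDigit (a m) ≡ just e → ∃[ i ] (n i ≡ m)) where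

  open KeptDigits s
  open StrictlyIncreasing n-increasing

  unkept : ∀ t → (∀ i → n i ≢ t) → keepDigit (a t) ≡ nothing
  unkept t t∉n with keepDigit (a t) in eq
  ... | nothing = refl
  ... | just _  = let (i , nᵢ≡t) = kept⇒∈n t eq in contradiction nᵢ≡t (t∉n i)

  NextKept : ℕ → ℕ → Set
  NextKept p j = p ≤ n j × (∀ t → p ≤ t → t < n j → keepDigit (a t) ≡ nothing)

  nextKept-zero : NextKept 0 0
  nextKept-zero = z≤n , λ t _ t<n₀ → unkept t λ i nᵢ≡t →
    ℕ.n≮0 (n-cancel-< (subst (_< n 0) (sym nᵢ≡t) t<n₀))

  nextKept-skip : ∀ {p j} → NextKept p j → keepDigit (a p) ≡ nothing → NextKept (suc p) j
  nextKept-skip {p} {j} (p≤nⱼ , gap) unkept-p =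
    ℕ.≤∧≢⇒< p≤nⱼ p≢nⱼ , λ t p<t → gap t (ℕ.<⇒≤ p<t)
    where
    p≢nⱼ : p ≢ n j
    p≢nⱼ refl with () ← trans (sym unkept-p) (keep-a∘n j)

  nextKept-keep : ∀ {p j e} → NextKept p j → keepDigit (a p) ≡ just e → p ≡ n j × NextKept (suc p) (suc j)
  nextKept-keep {p} {j} (p≤nⱼ , gap) kept-p = p≡nⱼ , ℕ.<-≤-trans (s≤s (ℕ.≤-reflexive p≡nⱼ)) (n-increasing j) ,
    λ t p<t t<nⱼ₊₁ → unkept t λ i nᵢ≡t →
      let j<i = n-cancel-< (subst₂ _<_ p≡nⱼ (sym nᵢ≡t) p<t)
          i<j+1 = n-cancel-< (subst (_< n (suc j)) (sym nᵢ≡t) t<nⱼ₊₁)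
      in ℕ.<-irrefl refl (ℕ.<-≤-trans j<i (ℕ.≤-pred i<j+1))
    where
    p≡nⱼ : p ≡ n j
    p≡nⱼ with ℕ.m≤n⇒m<n∨m≡n p≤nⱼ
    ... | inj₂ p≡nⱼ = p≡nⱼ
    ... | inj₁ p<nⱼ with () ← trans (sym kept-p) (gap p ℕ.≤-refl p<nⱼ)

  keptBefore : ℕ → ℕ
  keptBefore = windowSum a keptAt

  nextKept-keptBefore : ∀ M → NextKept M (keptBefore M)
  nextKept-keptBefore zero = nextKept-zero
  nextKept-keptBefore (suc M) with keepDigit (a M) in eq
  ... | nothing = subst (NextKept (suc M)) (sym (ℕ.+-identityʳ (keptBefore M)))
                        (nextKept-skip (nextKept-keptBefore M) eq)
  ... | just _  = subst (NextKept (suc M)) (ℕ.+-comm 1 (keptBefore M))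
                        (proj₂ (nextKept-keep (nextKept-keptBefore M) eq))

  keptBefore-n : ∀ j → keptBefore (n j) ≡ j
  keptBefore-n j with nextKept-keptBefore (n j)
  ... | nⱼ≤ , gap with ℕ.<-cmp j (keptBefore (n j))
  ...   | tri≈ _ j≡ _ = sym j≡
  ...   | tri< j< _ _ with () ← trans (sym (keep-a∘n j)) (gap (n j) ℕ.≤-refl (n-mono-< j<))
  ...   | tri> _ _ >j = contradiction nⱼ≤ (ℕ.<⇒≱ (n-mono-< >j))

  matchAt-if-keptStartsWith : ∀ L {p j k} (c : Vec (Fin s) k) → NextKept p j →
    T (keptStartsWith c (window a p L)) → T (matchAt d j c)
  matchAt-if-keptStartsWith L       []      next _  = _
  matchAt-if-keptStartsWith (suc L) {p} {j} (e ∷ c) next h with keepDigit (a p) in eq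
  ... | nothing = matchAt-if-keptStartsWith L (e ∷ c) (nextKept-skip next eq) h
  ... | just x  = matched (Equivalence.to T-∧ h) (nextKept-keep next eq)
    where
    matched : T ⌊ x Fin.≟ e ⌋ × T (keptStartsWith c (window a (suc p) L)) → p ≡ n j × NextKept (suc p) (suc j) →
              T (matchAt d j (e ∷ c))
    matched (x≡e , rest) (refl , next′) = Equivalence.from T-∧
      (fromWitness (trans (just-injective (trans (sym (keep-a∘n j)) eq)) (toWitness x≡e)) ,
       matchAt-if-keptStartsWith L c next′ rest)

  keptStartsWith⊎fewer-if-matchAt : ∀ L {p j k} (c : Vec (Fin s) k) → NextKept p j → T (matchAt d j c) →
    T (keptStartsWith c (window a p L)) ⊎ T (keptFewerThan k (window a p L))
  keptStartsWith⊎fewer-if-matchAt L       []      next _ = inj₁ _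
  keptStartsWith⊎fewer-if-matchAt zero    (e ∷ c) next _ = inj₂ _
  keptStartsWith⊎fewer-if-matchAt (suc L) {p} {j} {suc k} (e ∷ c) next h with keepDigit (a p) in eq
  ... | nothing = keptStartsWith⊎fewer-if-matchAt L (e ∷ c) (nextKept-skip next eq) h
  ... | just x  = extend (Equivalence.to T-∧ h) (nextKept-keep next eq)
    where
    extend : T ⌊ d j Fin.≟ e ⌋ × T (matchAt d (suc j) c) → p ≡ n j × NextKept (suc p) (suc j) →
             T (⌊ x Fin.≟ e ⌋ ∧ keptStartsWith c (window a (suc p) L)) ⊎ T (keptFewerThan k (window a (suc p) L))
    extend (dⱼ≡e , rest) (refl , next′) with keptStartsWith⊎fewer-if-matchAt L c next′ rest
    ... | inj₂ fewer  = inj₂ fewer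
    ... | inj₁ starts = inj₁ (Equivalence.from T-∧
      (fromWitness (trans (just-injective (trans (sym eq) (keep-a∘n j))) (toWitness dⱼ≡e)) , starts))

  count-keptBefore : ∀ {k} (c : Vec (Fin s) k) M →
    count d c (keptBefore M) ≡ sumUpTo (λ p → 𝟙 (is-just (keepDigit (a p)) ∧ matchAt d (keptBefore p) c)) M
  count-keptBefore c zero    = refl
  count-keptBefore c (suc M) with keepDigit (a M)
  ... | nothing = trans (cong (count d c) (ℕ.+-identityʳ (keptBefore M)))
                        (trans (count-keptBefore c M) (sym (ℕ.+-identityʳ _)))
  ... | just _  = trans (cong (count d c) (ℕ.+-comm (keptBefore M) 1))
                        (cong (_+ 𝟙 (matchAt d (keptBefore M) c)) (count-keptBefore c M))

  count-at-n : ∀ {k} (c : Vec (Fin s) k) D →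
    count d c D ≡ sumUpTo (λ p → 𝟙 (is-just (keepDigit (a p)) ∧ matchAt d (keptBefore p) c)) (n D)
  count-at-n c D = trans (cong (count d c) (sym (keptBefore-n D))) (count-keptBefore c (n D))

  count≥startsAtKept : ∀ L {k} (c : Vec (Fin s) k) D → windowSum a (startsAtKept {L = L} c) (n D) ≤ count d c D
  count≥startsAtKept L c D = subst (_ ≤_) (sym (count-at-n c D))
    (sumUpTo-mono-≤ (λ p → 𝟙-mono λ h → let (kept , starts) = Equivalence.to T-∧ h in
      Equivalence.from T-∧ (kept , matchAt-if-keptStartsWith (suc L) c (nextKept-keptBefore p) starts)) (n D))

  count≤startsAtKept+fewerAtKept : ∀ L {k} (c : Vec (Fin s) k) D →
    count d c D ≤ windowSum a (startsAtKept {L = L} c) (n D) + windowSum a (fewerAtKept {L = L} k) (n D)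
  count≤startsAtKept+fewerAtKept L {k} c D =
    subst₂ _≤_ (sym (count-at-n c D))
               (sumUpTo-+ (λ p → startsAtKept c (window a p (suc L))) (λ p → fewerAtKept k (window a p (suc L))) (n D))
      (sumUpTo-mono-≤ (λ p → 𝟙-≤-+ λ h → let (kept , match) = Equivalence.to T-∧ h in
        Sum.map (λ starts → Equivalence.from T-∧ (kept , starts)) (λ fewer → Equivalence.from T-∧ (kept , fewer))
                (keptStartsWith⊎fewer-if-matchAt (suc L) c (nextKept-keptBefore p) match)) (n D))

-- With X = s^k and P = b^L, these are (F + s T) b / (b P s) ≤ 1 / (s X) + 1 / (2R)
-- and F b / (b P s) ≥ 1 / (s X) - 1 / (2R), with denominators cleared.
private
  upper-estimate : ∀ b s X F T P R → X * F + T ≡ P → 2 * R * T ≤ P →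
    (F + s * T) * (b * 1) * (s * X) * (2 * R) ≤ 1 * (b * P * s) * (2 * R) + b * P * s * (s * X)
  upper-estimate b s X F T P R partition small = begin
    (F + s * T) * (b * 1) * (s * X) * (2 * R)    ≡⟨ factor₁ b s X F T R ⟩
    b * s * ((X * F + s * X * T) * (2 * R))
      ≤⟨ ℕ.*-monoʳ-≤ (b * s) (ℕ.≤-trans (ℕ.m≤m+n _ (T * (2 * R))) core) ⟩
    b * s * (P * (2 * R) + P * (s * X))          ≡⟨ factor₂ b s X P R ⟩
    1 * (b * P * s) * (2 * R) + b * P * s * (s * X) ∎
    where
    open ℕ.≤-Reasoning
    factor₁ : ∀ b s X F T R → (F + s * T) * (b * 1) * (s * X) * (2 * R) ≡ b * s * ((X * F + s * X * T) * (2 * R))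
    factor₁ = solve-∀
    factor₂ : ∀ b s X P R → b * s * (P * (2 * R) + P * (s * X)) ≡ 1 * (b * P * s) * (2 * R) + b * P * s * (s * X)
    factor₂ = solve-∀
    regroup : ∀ X F T s R → (X * F + s * X * T) * (2 * R) + T * (2 * R) ≡ (X * F + T) * (2 * R) + s * X * (2 * R * T)
    regroup = solve-∀

    core : (X * F + s * X * T) * (2 * R) + T * (2 * R) ≤ P * (2 * R) + P * (s * X)
    core = begin
      (X * F + s * X * T) * (2 * R) + T * (2 * R) ≡⟨ regroup X F T s R ⟩
      (X * F + T) * (2 * R) + s * X * (2 * R * T) ≡⟨ cong (λ t → t * (2 * R) + s * X * (2 * R * T)) partition ⟩
      P * (2 * R) + s * X * (2 * R * T)           ≤⟨ ℕ.+-monoʳ-≤ (P * (2 * R)) (ℕ.*-monoʳ-≤ (s * X) small) ⟩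
      P * (2 * R) + s * X * P                     ≡⟨ cong (P * (2 * R) +_) (ℕ.*-comm (s * X) P) ⟩
      P * (2 * R) + P * (s * X)                   ∎
  lower-estimate : ∀ b s X F T P R → X * F + T ≡ P → 2 * R * T ≤ P → 1 ≤ s * X →
    1 * (b * P * s) * (2 * R) ≤ F * (b * 1) * (s * X) * (2 * R) + b * P * s * (s * X)
  lower-estimate b s X F T P R partition small 1≤sX = begin
    1 * (b * P * s) * (2 * R)                        ≡⟨ factor₁ b s P R ⟩
    b * s * (P * (2 * R))                            ≤⟨ ℕ.*-monoʳ-≤ (b * s) core ⟩
    b * s * (X * F * (2 * R) + P * (s * X))          ≡⟨ factor₂ b s X F P R ⟩
    F * (b * 1) * (s * X) * (2 * R) + b * P * s * (s * X) ∎
    where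
    open ℕ.≤-Reasoning
    factor₁ : ∀ b s P R → 1 * (b * P * s) * (2 * R) ≡ b * s * (P * (2 * R))
    factor₁ = solve-∀
    factor₂ : ∀ b s X F P R →
              b * s * (X * F * (2 * R) + P * (s * X)) ≡ F * (b * 1) * (s * X) * (2 * R) + b * P * s * (s * X)
    factor₂ = solve-∀
    regroup : ∀ X F T R → (X * F + T) * (2 * R) ≡ X * F * (2 * R) + 2 * R * T
    regroup = solve-∀
    core : P * (2 * R) ≤ X * F * (2 * R) + P * (s * X)
    core = begin
      P * (2 * R)                   ≡⟨ cong (_* (2 * R)) partition ⟨
      (X * F + T) * (2 * R)         ≡⟨ regroup X F T R ⟩
      X * F * (2 * R) + 2 * R * T   ≤⟨ ℕ.+-monoʳ-≤ (X * F * (2 * R)) (ℕ.≤-trans small (ℕ.m≤m*n P (s * X))) ⟩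
      X * F * (2 * R) + P * (s * X) ∎
      where instance _ = ℕ.>-nonZero 1≤sX

module _ {s : ℕ} (1≤s : 1 ≤ s) (a : Digits (suc s)) (d : Digits s) (n : ℕ → ℕ)
  (n-increasing : ∀ i → n i < n (suc i))
  (keep-a∘n : ∀ i → keepDigit (a (n i)) ≡ just (d i))
  (kept⇒∈n : ∀ m {e} → keepDigit (a m) ≡ just e → ∃[ i ] (n i ≡ m))
  (a-normal : ∀ L (w : Vec (Fin (suc s)) L) → Density (count a w) 1 (suc s ^ L)) where

  open KeptDigits s
  open Subsequence a d n n-increasing keep-a∘n kept⇒∈n
  open StrictlyIncreasing n-increasing using (n-grows)

  private
    b = suc s

    density-keptBefore : Density keptBefore s (b ^ 1)
    density-keptBefore = density-cong (λ _ → refl) ∑Words-keptAt (density-windowSum a 1 (a-normal 1) keptAt)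

    density-startsAtKept : ∀ L {k} e (c : Vec (Fin s) k) →
      Density (windowSum a (startsAtKept {L = L} (e ∷ c))) (#keptStartsWith c L) (b ^ suc L)
    density-startsAtKept L e c =
      density-cong (λ _ → refl) (∑Words-startsAtKept L e c)
        (density-windowSum a (suc L) (a-normal (suc L)) (startsAtKept (e ∷ c)))

    density-fewerAtKept : ∀ L k →
      Density (windowSum a (fewerAtKept {L = L} (suc k))) (s * #keptFewerThan k L) (b ^ suc L)
    density-fewerAtKept L k =
      density-cong (λ _ → refl) (∑Words-fewerAtKept L k)
        (density-windowSum a (suc L) (a-normal (suc L)) (fewerAtKept (suc k)))

    instance _ = ℕ.>-nonZero 1≤s

  density-count : ∀ k (c : Vec (Fin s) k) → Density (count d c) 1 (s ^ k)
  density-count zero    []      = density-cong (λ M → sym (count-[] d M)) refl density-id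
  density-count (suc k) (e ∷ c) = density (atMost-approx upper) (atLeast-approx lower)
    where
    q′>0 : ∀ L → 0 < b ^ suc L * s
    q′>0 L = ℕ.*-mono-≤ (ℕ.m^n>0 b (suc L)) 1≤s

    upper : ∀ R → ∃[ p ] ∃[ q′ ] (0 < q′ × p * s ^ suc k * (2 * R) ≤ 1 * q′ * (2 * R) + q′ * s ^ suc k ×
                                  RatioAtMost (count d (e ∷ c)) id p q′)
    upper R with #keptFewerThan-small 1≤s k (2 * R)
    ... | L , small = _ , _ , q′>0 L , upper-estimate b s (s ^ k) _ _ _ R (#kept-partition L c) small ,
      atMost-mono (count≤startsAtKept+fewerAtKept L (e ∷ c))
        (atMost-along n-grows keptBefore-n
          (atMost-divide (ℕ.m^n>0 b (suc L)) 1≤s (ℕ.m^n>0 b 1)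
            (Density.upper (density-+ (density-startsAtKept L e c) (density-fewerAtKept L k)))
            density-keptBefore))

    lower : ∀ R → ∃[ p ] ∃[ q′ ] (0 < q′ × 1 * q′ * (2 * R) ≤ p * s ^ suc k * (2 * R) + q′ * s ^ suc k ×
                                  RatioAtLeast (count d (e ∷ c)) id p q′)
    lower R with #keptFewerThan-small 1≤s k (2 * R)
    ... | L , small = _ , _ , q′>0 L ,
      lower-estimate b s (s ^ k) _ _ _ R (#kept-partition L c) small (ℕ.*-mono-≤ 1≤s (ℕ.m^n>0 s k)) ,
      atLeast-mono (count≥startsAtKept L (e ∷ c))
        (atLeast-along n-grows keptBefore-n
          (atLeast-divide (ℕ.m^n>0 b (suc L)) 1≤s (ℕ.m^n>0 b 1)
            (Density.lower (density-startsAtKept L e c))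
            density-keptBefore))

theorem1p2 : (b : ℕ) → (hb : 2 ≤ b) → (a : ℕ → Fin b) →
    Normal b {{nonZero-b hb}} a →
    (n : ℕ → ℕ) → (∀ i → n i < n (suc i)) →
    (∀ i → toℕ (a (n i)) < b ∸ 1) →
    (∀ m → toℕ (a m) < b ∸ 1 → ∃[ i ] (n i ≡ m)) →
    (d : ℕ → Fin (b ∸ 1)) → (∀ i → toℕ (d i) ≡ toℕ (a (n i))) →
    Normal (b ∸ 1) {{nonZero-b-1 hb}} d
theorem1p2 (suc (suc s)) (s≤s (s≤s z≤n)) a a-normal n n-increasing _ kept⇒∈n d d≡a∘n =
  density⇒normal (suc s) d
    (density-count (s≤s z≤n) a d n n-increasing
      (λ i → keepDigit-toℕ (a (n i)) (d i) (sym (d≡a∘n i)))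
      (λ m kept → kept⇒∈n m (keepDigit-just⇒< (a m) kept))
      (normal⇒density (suc (suc s)) a a-normal))
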